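{- Let $G$ be a finite group. Then the power graph $P(G)$ is $\{\text{diamond}, \text{co-diamond}\}$-free if and only if $G$ is either a cyclic group of prime power order or a $2$-group of exponent $2$.
   Context: The power graph $P(G)$ of a group $G$ has vertex set $G$, with distinct $u,v$ adjacent if and only if $u=v^m$ or $v=u^n$ for some positive integers $m,n$. The diamond graph is $K_4$ with one edge deleted; the co-diamond is its complement (i.e. $K_2$ together with two isolated vertices). A graph is $\{H_1,H_2\}$-free if it contains no induced subgraph isomorphic to $H_1$ and none isomorphic to $H_2$. -}

module Defs where

open import Level using (Level; _⊔_)
open import Data.Nat using (ℕ; zero; suc; _≤_; _<_)
import Data.Nat as ℕ
open import Data.Nat.Primality using (Prime)
open import Data.Fin using (Fin)
open import Data.Product using (Σ; ∃; ∃-syntax; _×_; _,_)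
open import Data.Sum using (_⊎_)
open import Relation.Nullary using (¬_)
open import Relation.Binary.PropositionalEquality using (_≡_)
import Relation.Binary.PropositionalEquality as ≡
open import Function.Bundles using (Inverse)
open import Algebra.Bundles using (Group)

module _ {c ℓ : Level} (G : Group c ℓ) where
  open Group G

  infixr 8 _^_
  _^_ : Carrier → ℕ → Carrier
  x ^ zero = ε
  x ^ suc m = x ∙ (x ^ m)

  HasOrder : ℕ → Set (c ⊔ ℓ)
  HasOrder n = Inverse (≡.setoid (Fin n)) setoid

  PowAdj : Carrier → Carrier → Set ℓ
  PowAdj u v = (¬ (u ≈ v)) ×
    ((∃[ m ] (0 < m × u ≈ v ^ m)) ⊎ (∃[ m ] (0 < m × v ≈ u ^ m)))

  Distinct4 : Carrier → Carrier → Carrier → Carrier → Set ℓ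
  Distinct4 a b c d = ¬ (a ≈ b) × ¬ (a ≈ c) × ¬ (a ≈ d)
                    × ¬ (b ≈ c) × ¬ (b ≈ d) × ¬ (c ≈ d)

  InducedDiamond : Carrier → Carrier → Carrier → Carrier → Set ℓ
  InducedDiamond a b c d = Distinct4 a b c d
    × PowAdj a b × PowAdj a c × PowAdj a d × PowAdj b c × PowAdj b d
    × ¬ PowAdj c d

  InducedCoDiamond : Carrier → Carrier → Carrier → Carrier → Set ℓ
  InducedCoDiamond a b c d = Distinct4 a b c d
    × PowAdj a b × ¬ PowAdj a c × ¬ PowAdj a d × ¬ PowAdj b c × ¬ PowAdj b d
    × ¬ PowAdj c d

  DiamondCoDiamondFree : Set (c ⊔ ℓ)
  DiamondCoDiamondFree =
    (¬ (∃[ a ] ∃[ b ] ∃[ c ] ∃[ d ] InducedDiamond a b c d)) ×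
    (¬ (∃[ a ] ∃[ b ] ∃[ c ] ∃[ d ] InducedCoDiamond a b c d))

  IsCyclic : Set (c ⊔ ℓ)
  IsCyclic = ∃[ g ] (∀ x → ∃[ k ] (x ≈ g ^ k))

  HasExponent : ℕ → Set (c ⊔ ℓ)
  HasExponent m = 0 < m × (∀ x → x ^ m ≈ ε) ×
    (∀ m′ → 0 < m′ → (∀ x → x ^ m′ ≈ ε) → m ≤ m′)

IsPrimePower : ℕ → Set
IsPrimePower n = ∃[ p ] ∃[ k ] (Prime p × n ≡ p ℕ.^ k)

IsPowerOf2 : ℕ → Set
IsPowerOf2 n = ∃[ k ] (n ≡ 2 ℕ.^ k)

module Submission where

-- Write x ⇝ y when y is a positive power of x; distinct vertices of P(G) are
-- adjacent exactly when they are ⇝-comparable.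
--
-- If ⇝ is total, P(G) is complete and so contains neither graph. This is the case
-- for a cyclic group ⟨g⟩ of order pᵏ: writing a = pⁱ·u with p ∤ u, the element gᵃ
-- generates the same subgroup as g^(pⁱ) (Bézout, since u is prime to pᵏ), and these
-- subgroups form a chain. In a group of exponent 2 every edge of P(G) contains ε, so
-- P(G) is a star.
--
-- Conversely, let P(G) be diamond- and co-diamond-free. If x² ≠ ε for some x, every v
-- is comparable with x: otherwise x, x⁻¹, v, xv induce a co-diamond, or ε, xv, x, v a
-- diamond. Then any u, v are comparable, since otherwise ε, x, u, v induce a diamond.
-- A ⇝-greatest element g generates G, and two primes p ≠ q dividing n would make
-- g^(n/p) and g^(n/q) incomparable, so G is cyclic of prime-power order. If x² = ε for
-- all x, G is abelian, and adjoining to a subgroup an element outside it doubles its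
-- order, so n is a power of 2.

open import Level using (Level; _⊔_)
open import Data.Nat as ℕ using (ℕ; zero; suc; _+_; _*_; _≤_; _<_; z≤n; s≤s; z<s; NonZero)
import Data.Nat.Properties as ℕP
open import Data.Nat.DivMod using (_%_; _/_; m%n<n; m≡m%n+[m/n]*n)
open import Data.Nat.Divisibility
open import Data.Nat.Coprimality using (Coprime; coprime-divisor; coprime-Bézout)
import Data.Nat.Coprimality as Coprimality
open import Data.Nat.GCD using (module Bézout)
open import Data.Nat.Primality using (Prime; prime⇒irreducible; prime⇒nonTrivial; ¬prime[1]; prime[2])
open import Data.Nat.Primality.Factorisation using (factorise)
open import Data.Nat.ListAction using (product)
open import Data.Nat.Induction using (<-wellFounded)
open import Induction.WellFounded using (Acc; acc)
open import Data.List using (List; []; _∷_; length)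
open import Data.List.Relation.Unary.All using (All; []; _∷_)
open import Data.Fin as Fin using (Fin; toℕ; fromℕ<; splitAt; join)
import Data.Fin.Properties as FinP
open import Data.Product as Product using (∃; ∃₂; ∃-syntax; _×_; _,_; proj₁; proj₂)
open import Data.Sum as Sum using (_⊎_; inj₁; inj₂; [_,_]′)
open import Data.Empty using (⊥; ⊥-elim)
open import Function.Base using (_∘_)
open import Function.Bundles using (Inverse; Injection; _⇔_; mk⇔)
open import Function.Properties.Inverse using (Inverse⇒Injection; ↔⇒↣)
open import Relation.Nullary using (¬_; Dec; yes; no)
open import Relation.Nullary.Decidable using (map′; _×-dec_; _⊎-dec_)
open import Relation.Unary using (Decidable)
open import Relation.Binary.Core using (_Preserves_⟶_)
open import Relation.Binary.Definitions using (Reflexive; Transitive; Total; _Respects_; tri<; tri≈; tri>)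
import Relation.Binary.PropositionalEquality as ≡
open ≡ using (_≡_)
open import Algebra.Bundles using (Group)
open import Defs hiding (_^_)
import Defs

module Arithmetic where
  open import Data.Nat using (_^_)

  IsLeast : ∀ {p} → (ℕ → Set p) → ℕ → Set p
  IsLeast P m = P m × (∀ {k} → k < m → ¬ P k)

  leastWitness : ∀ {p} {P : ℕ → Set p} → Decidable P → ∀ {d} → P d → ∃ (IsLeast P)
  leastWitness {P = P} P? {d} Pd with search (suc d)
    where
    search : ∀ b → (∀ {k} → k < b → ¬ P k) ⊎ ∃ (IsLeast P)
    search zero = inj₁ λ ()
    search (suc b) with search b
    ... | inj₂ least = inj₂ least
    ... | inj₁ none with P? b
    ...   | yes Pb = inj₂ (b , Pb , none)
    ...   | no ¬Pb = inj₁ λ k<1+b → [ none , (λ { ≡.refl → ¬Pb }) ]′ (ℕP.m<1+n⇒m<n∨m≡n k<1+b)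
  ... | inj₁ none = ⊥-elim (none (ℕP.n<1+n d) Pd)
  ... | inj₂ least = least

  prime∣prime⇒≡ : ∀ {p q} → Prime p → Prime q → q ∣ p → q ≡ p
  prime∣prime⇒≡ pp pq q∣p with prime⇒irreducible pp q∣p
  ... | inj₁ ≡.refl = ⊥-elim (¬prime[1] pq)
  ... | inj₂ q≡p = q≡p

  prime∤⇒coprime : ∀ {p u} → Prime p → ¬ p ∣ u → Coprime p u
  prime∤⇒coprime pp p∤u (i∣p , i∣u) with prime⇒irreducible pp i∣p
  ... | inj₁ i≡1 = i≡1
  ... | inj₂ ≡.refl = ⊥-elim (p∤u i∣u)

  coprime-^ : ∀ {m u} → Coprime m u → ∀ k → Coprime (m ^ k) u
  coprime-^ m⊥u zero (i∣1 , _) = ∣1⇒≡1 i∣1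
  coprime-^ {m} m⊥u (suc k) {i} (i∣m*mᵏ , i∣u) = coprime-^ m⊥u k (coprime-divisor i⊥m i∣m*mᵏ , i∣u)
    where
    i⊥m : Coprime i m
    i⊥m (j∣i , j∣m) = m⊥u (j∣m , ∣-trans j∣i i∣u)

  p-adicSplit : ∀ {p} → Prime p → ∀ a → .{{NonZero a}} → ∃₂ λ i u → a ≡ p ^ i * u × ¬ p ∣ u
  p-adicSplit {p} pp a = split a (<-wellFounded a)
    where
    instance
      p-nonTrivial : ℕ.NonTrivial p
      p-nonTrivial = prime⇒nonTrivial pp
    split : ∀ a → .{{NonZero a}} → Acc _<_ a → ∃₂ λ i u → a ≡ p ^ i * u × ¬ p ∣ u
    split a (acc rec) with p ∣? a
    ... | no p∤a = 0 , a , ≡.sym (ℕP.*-identityˡ a) , p∤a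
    ... | yes p∣a@(divides q a≡q*p) with split q {{quotient≢0 p∣a}} (rec (quotient-< p∣a))
    ...   | i , u , q≡pⁱ*u , p∤u = suc i , u , a≡pⁱ⁺¹*u , p∤u
      where
      open ≡.≡-Reasoning
      a≡pⁱ⁺¹*u : a ≡ p * p ^ i * u
      a≡pⁱ⁺¹*u = begin
        a               ≡⟨ a≡q*p ⟩
        q * p           ≡⟨ ℕP.*-comm q p ⟩
        p * q           ≡⟨ ≡.cong (p *_) q≡pⁱ*u ⟩
        p * (p ^ i * u) ≡⟨ ℕP.*-assoc p (p ^ i) u ⟨
        p * p ^ i * u   ∎

  product≡^length : ∀ {a} {as : List ℕ} → All (_≡ a) as → product as ≡ a ^ length as
  product≡^length [] = ≡.refl
  product≡^length {a} (≡.refl ∷ as≡a) = ≡.cong (a *_) (product≡^length as≡a)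

  uniquePrimeDivisor⇒primePower : ∀ n → .{{NonZero n}} →
    (∀ {p q} → Prime p → Prime q → p ∣ n → q ∣ n → p ≡ q) → IsPrimePower n
  uniquePrimeDivisor⇒primePower n unique with factorise n
  ... | record { factors = [] ; isFactorisation = n≡1 } = 2 , 0 , prime[2] , n≡1
  ... | record { factors = a ∷ as ; isFactorisation = n≡a*Πas ; factorsPrime = pa ∷ pas } =
    a , suc (length as) , pa , ≡.trans n≡a*Πas (≡.cong (a *_) (product≡^length (allEqual as pas as∣n)))
    where
    as∣n : product as ∣ n
    as∣n = ∣-trans (n∣m*n a) (∣-reflexive (≡.sym n≡a*Πas))
    a∣n : a ∣ n
    a∣n = ∣-trans (m∣m*n (product as)) (∣-reflexive (≡.sym n≡a*Πas))
    allEqual : ∀ bs → All Prime bs → product bs ∣ n → All (_≡ a) bs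
    allEqual [] [] _ = []
    allEqual (b ∷ bs) (pb ∷ pbs) b*Πbs∣n =
      unique pb pa (∣-trans (m∣m*n (product bs)) b*Πbs∣n) a∣n ∷ allEqual bs pbs (∣-trans (n∣m*n b) b*Πbs∣n)

  ^-monoʳ-∣ : ∀ m {i j} → i ≤ j → m ^ i ∣ m ^ j
  ^-monoʳ-∣ m {i} {j} i≤j = divides (m ^ (j ℕ.∸ i)) (begin
    m ^ j                    ≡⟨ ≡.cong (m ^_) (ℕP.m+[n∸m]≡n i≤j) ⟨
    m ^ (i + (j ℕ.∸ i))      ≡⟨ ℕP.^-distribˡ-+-* m i (j ℕ.∸ i) ⟩
    m ^ i * m ^ (j ℕ.∸ i)    ≡⟨ ℕP.*-comm (m ^ i) _ ⟩
    m ^ (j ℕ.∸ i) * m ^ i    ∎)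
    where open ≡.≡-Reasoning

  isPowerOf2-double : ∀ {s} → IsPowerOf2 s → IsPowerOf2 (s + s)
  isPowerOf2-double (k , s≡2ᵏ) = suc k , ≡.cong₂ _+_ s≡2ᵏ (≡.trans s≡2ᵏ (≡.sym (ℕP.+-identityʳ (2 ^ k))))

  total⇒finiteFamilyBounded : ∀ {a r} {A : Set a} {R : A → A → Set r} →
    Reflexive R → Transitive R → Total R → A → ∀ m (f : Fin m → A) → ∃[ g ] (∀ i → R g (f i))
  total⇒finiteFamilyBounded R-refl R-trans total a zero f = a , λ ()
  total⇒finiteFamilyBounded R-refl R-trans total a (suc m) f
    with total⇒finiteFamilyBounded R-refl R-trans total a m (f ∘ Fin.suc)
  ... | g , g≤f with total g (f Fin.zero)
  ...   | inj₁ g≤f₀ = g , λ { Fin.zero → g≤f₀ ; (Fin.suc i) → g≤f i }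
  ...   | inj₂ f₀≤g = f Fin.zero , λ { Fin.zero → R-refl ; (Fin.suc i) → R-trans f₀≤g (g≤f i) }

open Arithmetic

module Powers {c ℓ : Level} (G : Group c ℓ) where
  open Group G
  open import Algebra.Properties.Monoid.Mult monoid using (×-congʳ; ×-homo-+; ×-assocˡ) renaming (_×_ to _·_)
  open import Algebra.Properties.Group G using (identityˡ-unique; inverseʳ-unique; ⁻¹-anti-homo-∙; ∙-cancelʳ)
  open import Relation.Binary.Reasoning.Setoid setoid

  infixr 8 _^_
  _^_ : Carrier → ℕ → Carrier
  _^_ = Defs._^_ G

  ^≡× : ∀ x m → x ^ m ≡ m · x
  ^≡× x zero = ≡.refl
  ^≡× x (suc m) = ≡.cong (x ∙_) (^≡× x m)

  ^-cong : ∀ m → (_^ m) Preserves _≈_ ⟶ _≈_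
  ^-cong m {x} {y} x≈y rewrite ^≡× x m | ^≡× y m = ×-congʳ m x≈y

  ^-homo-+ : ∀ x a b → x ^ (a + b) ≈ x ^ a ∙ x ^ b
  ^-homo-+ x a b rewrite ^≡× x (a + b) | ^≡× x a | ^≡× x b = ×-homo-+ x a b

  ^-* : ∀ x a b → (x ^ a) ^ b ≈ x ^ (b * a)
  ^-* x a b rewrite ^≡× x a | ^≡× (a · x) b | ^≡× x (b * a) = ×-assocˡ x b a

  ε^≈ε : ∀ m → ε ^ m ≈ ε
  ε^≈ε zero = refl
  ε^≈ε (suc m) = trans (identityˡ _) (ε^≈ε m)

  ^≈ε⇒^-multiple≈ε : ∀ {x d} → x ^ d ≈ ε → ∀ q → x ^ (q * d) ≈ ε
  ^≈ε⇒^-multiple≈ε {x} {d} xᵈ≈ε q = begin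
    x ^ (q * d)  ≈⟨ ^-* x d q ⟨
    (x ^ d) ^ q  ≈⟨ ^-cong q xᵈ≈ε ⟩
    ε ^ q        ≈⟨ ε^≈ε q ⟩
    ε            ∎

  ^≈ε⇒^≈^% : ∀ {x d} .{{_ : NonZero d}} → x ^ d ≈ ε → ∀ k → x ^ k ≈ x ^ (k % d)
  ^≈ε⇒^≈^% {x} {d} xᵈ≈ε k = begin
    x ^ k                              ≡⟨ ≡.cong (x ^_) (m≡m%n+[m/n]*n k d) ⟩
    x ^ (k % d + k / d * d)            ≈⟨ ^-homo-+ x (k % d) (k / d * d) ⟩
    x ^ (k % d) ∙ x ^ (k / d * d)      ≈⟨ ∙-congˡ (^≈ε⇒^-multiple≈ε xᵈ≈ε (k / d)) ⟩
    x ^ (k % d) ∙ ε                    ≈⟨ identityʳ _ ⟩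
    x ^ (k % d)                        ∎

  IsOrderOf : Carrier → ℕ → Set ℓ
  IsOrderOf x = IsLeast (λ k → 0 < k × x ^ k ≈ ε)

  module Order {x o} (x-order : IsOrderOf x o) where
    private
      0<o = proj₁ (proj₁ x-order)
      instance
        o-nonZero : NonZero o
        o-nonZero = ℕ.>-nonZero 0<o

    ^order≈ε : x ^ o ≈ ε
    ^order≈ε = proj₂ (proj₁ x-order)

    ^≈ε⇒order∣ : ∀ {k} → x ^ k ≈ ε → o ∣ k
    ^≈ε⇒order∣ {k} xᵏ≈ε =
      m%n≡0⇒n∣m k o (remainder≡0 (m%n<n k o) (trans (sym (^≈ε⇒^≈^% ^order≈ε k)) xᵏ≈ε))
      where
      remainder≡0 : ∀ {r} → r < o → x ^ r ≈ ε → r ≡ 0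
      remainder≡0 {zero} _ _ = ≡.refl
      remainder≡0 {suc r} r<o xʳ≈ε = ⊥-elim (proj₂ x-order r<o (z<s , xʳ≈ε))

    ^≉^-<order : ∀ {a b} → a < b → b < o → ¬ x ^ b ≈ x ^ a
    ^≉^-<order {a} {b} a<b b<o xᵇ≈xᵃ = proj₂ x-order (ℕP.≤-<-trans (ℕP.m∸n≤m b a) b<o)
      (ℕP.m<n⇒0<n∸m a<b , identityˡ-unique _ (x ^ a) (begin
        x ^ (b ℕ.∸ a) ∙ x ^ a  ≈⟨ ^-homo-+ x (b ℕ.∸ a) a ⟨
        x ^ (b ℕ.∸ a + a)      ≡⟨ ≡.cong (x ^_) (ℕP.m∸n+n≡m (ℕP.<⇒≤ a<b)) ⟩
        x ^ b                  ≈⟨ xᵇ≈xᵃ ⟩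
        x ^ a                  ∎))

    ^-injective-<order : ∀ {i j} → i < o → j < o → x ^ i ≈ x ^ j → i ≡ j
    ^-injective-<order {i} {j} i<o j<o xⁱ≈xʲ with ℕP.<-cmp i j
    ... | tri≈ _ i≡j _ = i≡j
    ... | tri< i<j _ _ = ⊥-elim (^≉^-<order i<j j<o (sym xⁱ≈xʲ))
    ... | tri> _ _ j<i = ⊥-elim (^≉^-<order j<i i<o xⁱ≈xʲ)

  infix 4 _⇝_
  _⇝_ : Carrier → Carrier → Set ℓ
  x ⇝ y = ∃[ m ] (0 < m × y ≈ x ^ m)

  -- PowAdj G u v is definitionally ¬ u ≈ v × Comparable u v.
  Comparable : Carrier → Carrier → Set ℓ
  Comparable u v = v ⇝ u ⊎ u ⇝ v

  ⇝-refl : ∀ {x} → x ⇝ x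
  ⇝-refl {x} = 1 , z<s , sym (identityʳ x)

  ⇝-trans : ∀ {x y z} → x ⇝ y → y ⇝ z → x ⇝ z
  ⇝-trans {x} {y} {z} (suc a , _ , y≈xᵃ) (suc b , _ , z≈yᵇ) = suc b * suc a , z<s , (begin
    z                ≈⟨ z≈yᵇ ⟩
    y ^ suc b        ≈⟨ ^-cong (suc b) y≈xᵃ ⟩
    (x ^ suc a) ^ suc b ≈⟨ ^-* x (suc a) (suc b) ⟩
    x ^ (suc b * suc a) ∎)

  ⇝-respʳ-≈ : ∀ {x y z} → y ≈ z → x ⇝ y → x ⇝ z
  ⇝-respʳ-≈ y≈z (m , 0<m , y≈xᵐ) = m , 0<m , trans (sym y≈z) y≈xᵐ

  ⇝-respˡ-≈ : ∀ {x y z} → x ≈ y → x ⇝ z → y ⇝ z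
  ⇝-respˡ-≈ {z = z} x≈y (m , 0<m , z≈xᵐ) = m , 0<m , trans z≈xᵐ (^-cong m x≈y)

  ⇝-∙ : ∀ {x a b} → x ⇝ a → x ⇝ b → x ⇝ a ∙ b
  ⇝-∙ {x} (suc i , _ , a≈xⁱ) (j , _ , b≈xʲ) =
    suc i + j , z<s , trans (∙-cong a≈xⁱ b≈xʲ) (sym (^-homo-+ x (suc i) j))

  comparable-sym : ∀ {u v} → Comparable u v → Comparable v u
  comparable-sym (inj₁ v⇝u) = inj₂ v⇝u
  comparable-sym (inj₂ u⇝v) = inj₁ u⇝v

  incomparable⇒≉ : ∀ {u v} → ¬ Comparable u v → ¬ u ≈ v
  incomparable⇒≉ ¬u~v u≈v = ¬u~v (inj₂ (⇝-respʳ-≈ u≈v ⇝-refl))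

  comparable-respˡ-≈ : ∀ {u u′ v} → u ≈ u′ → Comparable u v → Comparable u′ v
  comparable-respˡ-≈ u≈u′ (inj₁ v⇝u) = inj₁ (⇝-respʳ-≈ u≈u′ v⇝u)
  comparable-respˡ-≈ u≈u′ (inj₂ u⇝v) = inj₂ (⇝-respˡ-≈ u≈u′ u⇝v)

  ⇝-resp-^≈ε : ∀ {x y} k → x ^ k ≈ ε → x ⇝ y → y ^ k ≈ ε
  ⇝-resp-^≈ε {x} {y} k xᵏ≈ε (m , _ , y≈xᵐ) = begin
    y ^ k        ≈⟨ ^-cong k y≈xᵐ ⟩
    (x ^ m) ^ k  ≈⟨ ^-* x m k ⟩
    x ^ (k * m)  ≡⟨ ≡.cong (x ^_) (ℕP.*-comm k m) ⟩
    x ^ (m * k)  ≈⟨ ^≈ε⇒^-multiple≈ε xᵏ≈ε m ⟩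
    ε            ∎

  total⇒diamondCoDiamondFree : (∀ u v → Comparable u v) → DiamondCoDiamondFree G
  total⇒diamondCoDiamondFree total =
    (λ { (_ , _ , c , d , (_ , _ , _ , _ , _ , c≉d) , _ , _ , _ , _ , _ , ¬c~d) → ¬c~d (c≉d , total c d) }) ,
    (λ { (a , _ , c , _ , (_ , a≉c , _) , _ , ¬a~c , _) → ¬a~c (a≉c , total a c) })

  record ClosedSubset (s : ℕ) : Set (c ⊔ ℓ) where
    field
      element : Fin s → Carrier
      element-injective : ∀ {i j} → element i ≈ element j → i ≡ j
      element-closed : ∀ i j → ∃[ k ] (element i ∙ element j ≈ element k)

  trivialSubset : ClosedSubset 1
  trivialSubset = record
    { element = λ _ → ε
    ; element-injective = λ { {Fin.zero} {Fin.zero} _ → ≡.refl }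
    ; element-closed = λ _ _ → Fin.zero , identityˡ ε
    }

  hasExponent2⇒∙≈ε : HasExponent G 2 → ∀ x → x ∙ x ≈ ε
  hasExponent2⇒∙≈ε (_ , x²≈ε , _) x = trans (∙-congˡ (sym (identityʳ x))) (x²≈ε x)

  module Exponent2 (x∙x≈ε : ∀ x → x ∙ x ≈ ε) where

    ⁻¹≈id : ∀ x → x ⁻¹ ≈ x
    ⁻¹≈id x = sym (inverseʳ-unique x x (x∙x≈ε x))

    ∙-comm : ∀ x y → x ∙ y ≈ y ∙ x
    ∙-comm x y = begin
      x ∙ y          ≈⟨ ⁻¹≈id (x ∙ y) ⟨
      (x ∙ y) ⁻¹     ≈⟨ ⁻¹-anti-homo-∙ x y ⟩
      y ⁻¹ ∙ x ⁻¹    ≈⟨ ∙-cong (⁻¹≈id y) (⁻¹≈id x) ⟩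
      y ∙ x          ∎

    ^≈ε⊎^≈id : ∀ x m → x ^ m ≈ ε ⊎ x ^ m ≈ x
    ^≈ε⊎^≈id x zero = inj₁ refl
    ^≈ε⊎^≈id x (suc m) with ^≈ε⊎^≈id x m
    ... | inj₁ xᵐ≈ε = inj₂ (trans (∙-congˡ xᵐ≈ε) (identityʳ x))
    ... | inj₂ xᵐ≈x = inj₁ (trans (∙-congˡ xᵐ≈x) (x∙x≈ε x))

    ⇝-≈ε⊎≈ : ∀ {x y} → x ⇝ y → y ≈ ε ⊎ y ≈ x
    ⇝-≈ε⊎≈ {x} (m , _ , y≈xᵐ) = Sum.map (trans y≈xᵐ) (trans y≈xᵐ) (^≈ε⊎^≈id x m)

    ≈ε⇒comparable : ∀ {u} v → u ≈ ε → Comparable u v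
    ≈ε⇒comparable v u≈ε = inj₁ (2 , z<s , trans u≈ε (sym (trans (∙-congˡ (identityʳ v)) (x∙x≈ε v))))

    hasExponent2 : ∀ {x} → ¬ x ≈ ε → HasExponent G 2
    hasExponent2 {x} x≉ε = z<s , (λ y → trans (∙-congˡ (identityʳ y)) (x∙x≈ε y)) , at-least-2
      where
      at-least-2 : ∀ m → 0 < m → (∀ y → y ^ m ≈ ε) → 2 ≤ m
      at-least-2 (suc zero) _ y¹≈ε = ⊥-elim (x≉ε (trans (sym (identityʳ x)) (y¹≈ε x)))
      at-least-2 (suc (suc _)) _ _ = s≤s (s≤s z≤n)

    comparable⇒≈ε : ∀ {u v} → ¬ u ≈ v → Comparable u v → u ≈ ε ⊎ v ≈ ε
    comparable⇒≈ε u≉v (inj₁ v⇝u) with ⇝-≈ε⊎≈ v⇝u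
    ... | inj₁ u≈ε = inj₁ u≈ε
    ... | inj₂ u≈v = ⊥-elim (u≉v u≈v)
    comparable⇒≈ε u≉v (inj₂ u⇝v) with ⇝-≈ε⊎≈ u⇝v
    ... | inj₁ v≈ε = inj₂ v≈ε
    ... | inj₂ v≈u = ⊥-elim (u≉v (sym v≈u))

    diamondCoDiamondFree : DiamondCoDiamondFree G
    diamondCoDiamondFree = noDiamond , noCoDiamond
      where
      both≈ε : ∀ {u v} → u ≈ ε → v ≈ ε → u ≈ v
      both≈ε u≈ε v≈ε = trans u≈ε (sym v≈ε)
      noDiamond : ¬ (∃[ a ] ∃[ b ] ∃[ c ] ∃[ d ] InducedDiamond G a b c d)
      noDiamond (a , b , c , d , (a≉b , a≉c , _ , b≉c , _) , (_ , a~b) , (_ , a~c) , _ , (_ , b~c) , _)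
        with comparable⇒≈ε a≉b a~b
      ... | inj₁ a≈ε = [ a≉b ∘ both≈ε a≈ε , a≉c ∘ both≈ε a≈ε ]′ (comparable⇒≈ε b≉c b~c)
      ... | inj₂ b≈ε = [ (λ a≈ε → a≉b (both≈ε a≈ε b≈ε)) , b≉c ∘ both≈ε b≈ε ]′ (comparable⇒≈ε a≉c a~c)
      noCoDiamond : ¬ (∃[ a ] ∃[ b ] ∃[ c ] ∃[ d ] InducedCoDiamond G a b c d)
      noCoDiamond (a , b , c , d , (a≉b , a≉c , _ , b≉c , _) , (_ , a~b) , ¬a-c , _ , ¬b-c , _) =
        [ (λ a≈ε → ¬a-c (a≉c , ≈ε⇒comparable c a≈ε)) ,
          (λ b≈ε → ¬b-c (b≉c , ≈ε⇒comparable c b≈ε)) ]′ (comparable⇒≈ε a≉b a~b)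

    double : ∀ {s} (S : ClosedSubset s) {y} → ¬ (∃[ i ] ClosedSubset.element S i ≈ y) → ClosedSubset (s + s)
    double {s} S {y} y∉S = record
      { element = element′ ∘ splitAt s
      ; element-injective = λ e → Injection.injective (↔⇒↣ FinP.+↔⊎) (element′-injective e)
      ; element-closed = closed
      }
      where
      open ClosedSubset S
      element′ : Fin s ⊎ Fin s → Carrier
      element′ = [ element , (λ j → element j ∙ y) ]′

      coset-disjoint : ∀ i j → ¬ element i ≈ element j ∙ y
      coset-disjoint i j eᵢ≈eⱼy with element-closed j i
      ... | k , eⱼeᵢ≈eₖ = y∉S (k , (begin
        element k                      ≈⟨ eⱼeᵢ≈eₖ ⟨
        element j ∙ element i          ≈⟨ ∙-congˡ eᵢ≈eⱼy ⟩
        element j ∙ (element j ∙ y)    ≈⟨ assoc _ _ _ ⟨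
        (element j ∙ element j) ∙ y    ≈⟨ ∙-congʳ (x∙x≈ε _) ⟩
        ε ∙ y                          ≈⟨ identityˡ y ⟩
        y                              ∎))

      element′-injective : ∀ {a b} → element′ a ≈ element′ b → a ≡ b
      element′-injective {inj₁ i} {inj₁ j} e = ≡.cong inj₁ (element-injective e)
      element′-injective {inj₁ i} {inj₂ j} e = ⊥-elim (coset-disjoint i j e)
      element′-injective {inj₂ i} {inj₁ j} e = ⊥-elim (coset-disjoint j i (sym e))
      element′-injective {inj₂ i} {inj₂ j} e = ≡.cong inj₂ (element-injective (∙-cancelʳ y _ _ e))

      ∙y-slide : ∀ a b → (a ∙ y) ∙ b ≈ (a ∙ b) ∙ y
      ∙y-slide a b = trans (assoc a y b) (trans (∙-congˡ (∙-comm y b)) (sym (assoc a b y)))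

      closed′ : ∀ a b → ∃[ r ] (element′ a ∙ element′ b ≈ element′ r)
      closed′ (inj₁ i) (inj₁ j) with element-closed i j
      ... | k , eᵢeⱼ≈eₖ = inj₁ k , eᵢeⱼ≈eₖ
      closed′ (inj₁ i) (inj₂ j) with element-closed i j
      ... | k , eᵢeⱼ≈eₖ = inj₂ k , trans (sym (assoc _ _ _)) (∙-congʳ eᵢeⱼ≈eₖ)
      closed′ (inj₂ i) (inj₁ j) with element-closed i j
      ... | k , eᵢeⱼ≈eₖ = inj₂ k , trans (∙y-slide _ _) (∙-congʳ eᵢeⱼ≈eₖ)
      closed′ (inj₂ i) (inj₂ j) with element-closed i j
      ... | k , eᵢeⱼ≈eₖ = inj₁ k , (begin
        (element i ∙ y) ∙ (element j ∙ y)  ≈⟨ assoc _ _ _ ⟨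
        ((element i ∙ y) ∙ element j) ∙ y  ≈⟨ ∙-congʳ (∙y-slide _ _) ⟩
        ((element i ∙ element j) ∙ y) ∙ y  ≈⟨ assoc _ _ _ ⟩
        (element i ∙ element j) ∙ (y ∙ y)  ≈⟨ ∙-cong eᵢeⱼ≈eₖ (x∙x≈ε y) ⟩
        element k ∙ ε                      ≈⟨ identityʳ _ ⟩
        element k                          ∎)

      closed : ∀ a b → ∃[ r ] (element′ (splitAt s a) ∙ element′ (splitAt s b) ≈ element′ (splitAt s r))
      closed a b with closed′ (splitAt s a) (splitAt s b)
      ... | r , e = join s s r , trans e (reflexive (≡.cong element′ (≡.sym (FinP.splitAt-join s s r))))

module FiniteGroup {c ℓ : Level} (G : Group c ℓ) {n : ℕ} (G-order : HasOrder G n) where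
  open Group G
  open Powers G
  open import Algebra.Properties.Group G
    using (\\-leftDividesʳ; //-rightDividesʳ; inverseʳ-unique; ⁻¹-involutive; identityˡ-unique)
  open import Relation.Binary.Reasoning.Setoid setoid
  open Inverse G-order using (to; from; from-cong; strictlyInverseˡ)

  to-injective : ∀ {i j} → to i ≈ to j → i ≡ j
  to-injective = Injection.injective (Inverse⇒Injection G-order)

  from-injective : ∀ {x y} → from x ≡ from y → x ≈ y
  from-injective {x} {y} fx≡fy = begin
    x            ≈⟨ strictlyInverseˡ x ⟨
    to (from x)  ≡⟨ ≡.cong to fx≡fy ⟩
    to (from y)  ≈⟨ strictlyInverseˡ y ⟩
    y            ∎

  instance
    n-nonZero : NonZero n
    n-nonZero = ℕ.>-nonZero (ℕP.≤-<-trans z≤n (FinP.toℕ<n (from ε)))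

  infix 4 _≈?_
  _≈?_ : ∀ x y → Dec (x ≈ y)
  x ≈? y = map′ from-injective from-cong (from x Fin.≟ from y)

  ∀⊎∃¬ : ∀ {p} {P : Carrier → Set p} → P Respects _≈_ → (∀ x → Dec (P x)) →
         (∀ x → P x) ⊎ ∃[ x ] ¬ P x
  ∀⊎∃¬ {P = P} resp P? with FinP.all? (P? ∘ to)
  ... | yes ∀P = inj₁ λ x → resp (strictlyInverseˡ x) (∀P (from x))
  ... | no ¬∀P = inj₂ (Product.map to (λ ¬P → ¬P) (FinP.¬∀⟶∃¬ n (P ∘ to) (P? ∘ to) ¬∀P))

  ^≈ε-exists : ∀ x → ∃[ d ] (0 < d × x ^ d ≈ ε)
  ^≈ε-exists x with FinP.pigeonhole (ℕP.n<1+n n) (λ i → from (x ^ toℕ i))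
  ... | i , j , i<j , same = toℕ j ℕ.∸ toℕ i , ℕP.m<n⇒0<n∸m i<j , identityˡ-unique _ (x ^ toℕ i) (begin
    x ^ (toℕ j ℕ.∸ toℕ i) ∙ x ^ toℕ i  ≈⟨ ^-homo-+ x (toℕ j ℕ.∸ toℕ i) (toℕ i) ⟨
    x ^ (toℕ j ℕ.∸ toℕ i + toℕ i)      ≡⟨ ≡.cong (x ^_) (ℕP.m∸n+n≡m (ℕP.<⇒≤ i<j)) ⟩
    x ^ toℕ j                          ≈⟨ from-injective same ⟨
    x ^ toℕ i                          ∎)

  order-exists : ∀ x → ∃ (IsOrderOf x)
  order-exists x = leastWitness (λ k → (0 ℕ.<? k) ×-dec (x ^ k ≈? ε)) (proj₂ (^≈ε-exists x))

  ⇝-^ : ∀ x m → x ⇝ x ^ m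
  ⇝-^ x zero with ^≈ε-exists x
  ... | d , 0<d , xᵈ≈ε = d , 0<d , sym xᵈ≈ε
  ⇝-^ x (suc m) = suc m , z<s , refl

  ⇝-⁻¹ : ∀ x → x ⇝ x ⁻¹
  ⇝-⁻¹ x with ^≈ε-exists x
  ... | suc d , _ , xᵈ⁺¹≈ε = ⇝-respʳ-≈ (inverseʳ-unique x (x ^ d) xᵈ⁺¹≈ε) (⇝-^ x d)

  ⇝-⁻¹ʳ : ∀ {x y} → x ⇝ y → x ⇝ y ⁻¹
  ⇝-⁻¹ʳ x⇝y = ⇝-trans x⇝y (⇝-⁻¹ _)

  ⁻¹-⇝ : ∀ {x y} → x ⇝ y → x ⁻¹ ⇝ y
  ⁻¹-⇝ {x} x⇝y = ⇝-trans (⇝-respʳ-≈ (⁻¹-involutive x) (⇝-⁻¹ (x ⁻¹))) x⇝y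

  infix 4 _⇝?_
  _⇝?_ : ∀ x y → Dec (x ⇝ y)
  x ⇝? y with ^≈ε-exists x
  ... | d@(suc _) , _ , xᵈ≈ε =
    map′ (λ (i , y≈x^[1+i]) → suc (toℕ i) , z<s , y≈x^[1+i]) reduce
         (FinP.any? (λ (i : Fin d) → y ≈? x ^ suc (toℕ i)))
    where
    reduce : x ⇝ y → ∃[ i ] (y ≈ x ^ suc (toℕ i))
    reduce (suc m , _ , y≈xᵐ⁺¹) = fromℕ< (m%n<n m d) , (begin
      y                                       ≈⟨ y≈xᵐ⁺¹ ⟩
      x ∙ x ^ m                               ≈⟨ ∙-congˡ (^≈ε⇒^≈^% xᵈ≈ε m) ⟩
      x ∙ x ^ (m % d)                         ≡⟨ ≡.cong (λ r → x ∙ x ^ r) (FinP.toℕ-fromℕ< (m%n<n m d)) ⟨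
      x ∙ x ^ toℕ (fromℕ< (m%n<n m d))        ∎)

  comparable? : ∀ u v → Dec (Comparable u v)
  comparable? u v = (v ⇝? u) ⊎-dec (u ⇝? v)

  ε-comparable : ∀ x → Comparable ε x
  ε-comparable x = inj₁ (⇝-^ x 0)

  incomparable⇒≉ε : ∀ {u v} → ¬ Comparable u v → ¬ u ≈ ε
  incomparable⇒≉ε {v = v} ¬u~v u≈ε = ¬u~v (comparable-respˡ-≈ (sym u≈ε) (ε-comparable v))

  ^-divisor-⇝ : ∀ x {a b} → a ∣ b → x ^ a ⇝ x ^ b
  ^-divisor-⇝ x {a} (divides q b≡q*a) =
    ⇝-respʳ-≈ (trans (^-* x a q) (reflexive (≡.cong (x ^_) (≡.sym b≡q*a)))) (⇝-^ (x ^ a) q)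

  coprime-^-⇝ : ∀ {h N u} → h ^ N ≈ ε → Coprime u N → h ^ u ⇝ h
  coprime-^-⇝ {h} {N} {u} hᴺ≈ε u⊥N with coprime-Bézout u⊥N
  ... | Bézout.+- a b 1+b*N≡a*u = ⇝-respʳ-≈ (begin
    (h ^ u) ^ a     ≈⟨ ^-* h u a ⟩
    h ^ (a * u)     ≡⟨ ≡.cong (h ^_) 1+b*N≡a*u ⟨
    h ∙ h ^ (b * N) ≈⟨ ∙-congˡ (^≈ε⇒^-multiple≈ε hᴺ≈ε b) ⟩
    h ∙ ε           ≈⟨ identityʳ h ⟩
    h               ∎) (⇝-^ (h ^ u) a)
  ... | Bézout.-+ a b 1+a*u≡b*N =
    ⇝-respʳ-≈ (⁻¹-involutive h) (⇝-⁻¹ʳ (⇝-respʳ-≈ (inverseʳ-unique h _ h∙[hᵘ]ᵃ≈ε) (⇝-^ (h ^ u) a)))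
    where
    h∙[hᵘ]ᵃ≈ε : h ∙ (h ^ u) ^ a ≈ ε
    h∙[hᵘ]ᵃ≈ε = begin
      h ∙ (h ^ u) ^ a   ≈⟨ ∙-congˡ (^-* h u a) ⟩
      h ^ (1 + a * u)   ≡⟨ ≡.cong (h ^_) 1+a*u≡b*N ⟩
      h ^ (b * N)       ≈⟨ ^≈ε⇒^-multiple≈ε hᴺ≈ε b ⟩
      ε                 ∎

  ⁻¹-incomparable : ∀ {x z} → ¬ Comparable x z → ¬ Comparable (x ⁻¹) z
  ⁻¹-incomparable {x} x≁z (inj₁ z⇝x⁻¹) = x≁z (inj₁ (⇝-respʳ-≈ (⁻¹-involutive x) (⇝-⁻¹ʳ z⇝x⁻¹)))
  ⁻¹-incomparable {x} x≁z (inj₂ x⁻¹⇝z) = x≁z (inj₂ (⇝-trans (⇝-⁻¹ x) x⁻¹⇝z))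

  total⇒cyclic : (∀ u v → Comparable u v) → IsCyclic G
  total⇒cyclic total with total⇒finiteFamilyBounded ⇝-refl ⇝-trans (λ u v → total v u) ε n to
  ... | g , g⇝to = g , λ y → Product.map₂ proj₂ (⇝-respʳ-≈ (strictlyInverseˡ y) (g⇝to (from y)))

  module Generator {g : Carrier} (generates : ∀ y → ∃[ k ] (y ≈ g ^ k)) where

    order≡n : ∀ {o} → IsOrderOf g o → o ≡ n
    order≡n {o} g-order = ℕP.≤-antisym
      (FinP.injective⇒≤ {f = λ (i : Fin o) → from (g ^ toℕ i)}
        (λ same → FinP.toℕ-injective (^-injective-<order (FinP.toℕ<n _) (FinP.toℕ<n _) (from-injective same))))
      (FinP.injective⇒≤ {f = λ (i : Fin n) → fromℕ< (m%n<n (exponent (to i)) o)}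
        (λ same → to-injective (same-residue (FinP.fromℕ<-injective _ _ _ _ same))))
      where
      open Order g-order
      instance
        o-nonZero : NonZero o
        o-nonZero = ℕ.>-nonZero (proj₁ (proj₁ g-order))
      exponent : Carrier → ℕ
      exponent y = proj₁ (generates y)
      same-residue : ∀ {y z} → exponent y % o ≡ exponent z % o → y ≈ z
      same-residue {y} {z} eq = begin
        y                    ≈⟨ proj₂ (generates y) ⟩
        g ^ exponent y       ≈⟨ ^≈ε⇒^≈^% ^order≈ε (exponent y) ⟩
        g ^ (exponent y % o) ≡⟨ ≡.cong (g ^_) eq ⟩
        g ^ (exponent z % o) ≈⟨ ^≈ε⇒^≈^% ^order≈ε (exponent z) ⟨
        g ^ exponent z       ≈⟨ proj₂ (generates z) ⟨
        z                    ∎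

    private
      g-order = proj₂ (order-exists g)

    ^n≈ε : g ^ n ≈ ε
    ^n≈ε = ≡.subst (λ o → g ^ o ≈ ε) (order≡n g-order) (Order.^order≈ε g-order)

    ^≈ε⇒n∣ : ∀ {k} → g ^ k ≈ ε → n ∣ k
    ^≈ε⇒n∣ gᵏ≈ε = ≡.subst (_∣ _) (order≡n g-order) (Order.^≈ε⇒order∣ g-order gᵏ≈ε)

    total⇒primePower : (∀ u v → Comparable u v) → IsPrimePower n
    total⇒primePower total = uniquePrimeDivisor⇒primePower n unique
      where
      ⇝⇒≡ : ∀ {p q} s t → Prime p → Prime q → n ≡ s * p → n ≡ t * q → g ^ s ⇝ g ^ t → q ≡ p
      ⇝⇒≡ {p} {q} s t pp pq n≡s*p n≡t*q gˢ⇝gᵗ = prime∣prime⇒≡ pp pq (*-cancelˡ-∣ t t*q∣t*p)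
        where
        instance
          t-nonZero : NonZero t
          t-nonZero = ℕP.m*n≢0⇒m≢0 t {{≡.subst NonZero n≡t*q n-nonZero}}
        gˢ^p≈ε : (g ^ s) ^ p ≈ ε
        gˢ^p≈ε = begin
          (g ^ s) ^ p  ≈⟨ ^-* g s p ⟩
          g ^ (p * s)  ≡⟨ ≡.cong (g ^_) (≡.trans (ℕP.*-comm p s) (≡.sym n≡s*p)) ⟩
          g ^ n        ≈⟨ ^n≈ε ⟩
          ε            ∎
        t*q∣t*p : t * q ∣ t * p
        t*q∣t*p = ≡.subst₂ _∣_ n≡t*q (ℕP.*-comm p t)
          (^≈ε⇒n∣ (trans (sym (^-* g t p)) (⇝-resp-^≈ε p gˢ^p≈ε gˢ⇝gᵗ)))
      unique : ∀ {p q} → Prime p → Prime q → p ∣ n → q ∣ n → p ≡ q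
      unique pp pq (divides s n≡s*p) (divides t n≡t*q) with total (g ^ s) (g ^ t)
      ... | inj₁ gᵗ⇝gˢ = ⇝⇒≡ t s pq pp n≡t*q n≡s*p gᵗ⇝gˢ
      ... | inj₂ gˢ⇝gᵗ = ≡.sym (⇝⇒≡ s t pp pq n≡s*p n≡t*q gˢ⇝gᵗ)

    primePower⇒total : ∀ {p k} → Prime p → n ≡ p ℕ.^ k → ∀ u v → Comparable u v
    primePower⇒total {p} {k} pp n≡pᵏ u v with p-component u | p-component v
      where
      p-component : ∀ y → y ≈ ε ⊎ ∃[ i ] (y ⇝ g ^ (p ℕ.^ i) × g ^ (p ℕ.^ i) ⇝ y)
      p-component y with generates y
      ... | zero , y≈ε = inj₁ y≈ε
      ... | a@(suc _) , y≈gᵃ with p-adicSplit pp a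
      ...   | i , a′ , a≡pⁱ*a′ , p∤a′ =
        inj₂ (i , ⇝-respˡ-≈ (sym y≈hᵃ′) (coprime-^-⇝ hᵖᵏ≈ε a′⊥pᵏ) , ⇝-respʳ-≈ (sym y≈hᵃ′) (⇝-^ h a′))
        where
        h = g ^ (p ℕ.^ i)
        y≈hᵃ′ : y ≈ h ^ a′
        y≈hᵃ′ = begin
          y                  ≈⟨ y≈gᵃ ⟩
          g ^ a              ≡⟨ ≡.cong (g ^_) (≡.trans a≡pⁱ*a′ (ℕP.*-comm (p ℕ.^ i) a′)) ⟩
          g ^ (a′ * p ℕ.^ i) ≈⟨ ^-* g (p ℕ.^ i) a′ ⟨
          h ^ a′             ∎
        hᵖᵏ≈ε : h ^ (p ℕ.^ k) ≈ ε
        hᵖᵏ≈ε = ⇝-resp-^≈ε (p ℕ.^ k) (≡.subst (λ m → g ^ m ≈ ε) n≡pᵏ ^n≈ε) (⇝-^ g (p ℕ.^ i))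
        a′⊥pᵏ : Coprime a′ (p ℕ.^ k)
        a′⊥pᵏ = Coprimality.sym (coprime-^ (prime∤⇒coprime pp p∤a′) k)
    ... | inj₁ u≈ε | _ = comparable-respˡ-≈ (sym u≈ε) (ε-comparable v)
    ... | inj₂ _ | inj₁ v≈ε = comparable-sym (comparable-respˡ-≈ (sym v≈ε) (ε-comparable u))
    ... | inj₂ (i , u⇝gᵖⁱ , gᵖⁱ⇝u) | inj₂ (j , v⇝gᵖʲ , gᵖʲ⇝v) with ℕP.≤-total i j
    ...   | inj₁ i≤j = inj₂ (⇝-trans u⇝gᵖⁱ (⇝-trans (^-divisor-⇝ g (^-monoʳ-∣ p i≤j)) gᵖʲ⇝v))
    ...   | inj₂ j≤i = inj₁ (⇝-trans v⇝gᵖʲ (⇝-trans (^-divisor-⇝ g (^-monoʳ-∣ p j≤i)) gᵖⁱ⇝u))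

  module _ (free : DiamondCoDiamondFree G) where

    private
      nonadjacent : ∀ {u v} → ¬ Comparable u v → ¬ PowAdj G u v
      nonadjacent u≁v (_ , u~v) = u≁v u~v

    no-diamond : ∀ {a b c d} → Distinct4 G a b c d → Comparable a b → Comparable a c → Comparable a d →
                 Comparable b c → Comparable b d → ¬ Comparable c d → ⊥
    no-diamond distinct@(a≉b , a≉c , a≉d , b≉c , b≉d , _) a~b a~c a~d b~c b~d c≁d = proj₁ free
      (_ , _ , _ , _ , distinct , (a≉b , a~b) , (a≉c , a~c) , (a≉d , a~d) , (b≉c , b~c) , (b≉d , b~d) ,
       nonadjacent c≁d)

    no-coDiamond : ∀ {a b c d} → ¬ a ≈ b → Comparable a b → ¬ Comparable a c → ¬ Comparable a d →
                   ¬ Comparable b c → ¬ Comparable b d → ¬ Comparable c d → ⊥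
    no-coDiamond a≉b a~b a≁c a≁d b≁c b≁d c≁d = proj₂ free
      (_ , _ , _ , _ ,
       (a≉b , incomparable⇒≉ a≁c , incomparable⇒≉ a≁d ,
        incomparable⇒≉ b≁c , incomparable⇒≉ b≁d , incomparable⇒≉ c≁d) ,
       (a≉b , a~b) , nonadjacent a≁c , nonadjacent a≁d , nonadjacent b≁c , nonadjacent b≁d , nonadjacent c≁d)

    comparable-through : ∀ {b c d} → ¬ b ≈ ε → Comparable b c → Comparable b d → Comparable c d
    comparable-through {b} {c} {d} b≉ε b~c b~d with comparable? c d
    ... | yes c~d = c~d
    ... | no c≁d = ⊥-elim (no-diamond
      (b≉ε ∘ sym , incomparable⇒≉ε c≁d ∘ sym , incomparable⇒≉ε (c≁d ∘ comparable-sym) ∘ sym ,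
       (λ b≈c → c≁d (comparable-respˡ-≈ b≈c b~d)) ,
       (λ b≈d → c≁d (comparable-sym (comparable-respˡ-≈ b≈d b~c))) ,
       incomparable⇒≉ c≁d)
      (ε-comparable b) (ε-comparable c) (ε-comparable d) b~c b~d c≁d)

    comparable-nonInvolution : ∀ {x} → ¬ x ∙ x ≈ ε → ∀ v → Comparable x v
    comparable-nonInvolution {x} x∙x≉ε v with comparable? x v
    ... | yes x~v = x~v
    ... | no x≁v = ⊥-elim
      (no-coDiamond x≉x⁻¹ (inj₂ (⇝-⁻¹ x)) x≁v x≁w (⁻¹-incomparable x≁v) (⁻¹-incomparable x≁w) v≁w)
      where
      w = x ∙ v
      x⁻¹w≈v : x ⁻¹ ∙ w ≈ v
      x⁻¹w≈v = \\-leftDividesʳ x v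
      wv⁻¹≈x : w ∙ v ⁻¹ ≈ x
      wv⁻¹≈x = //-rightDividesʳ v x
      x≉x⁻¹ : ¬ x ≈ x ⁻¹
      x≉x⁻¹ x≈x⁻¹ = x∙x≉ε (trans (∙-congˡ x≈x⁻¹) (inverseʳ x))
      w≉ε : ¬ w ≈ ε
      w≉ε w≈ε = x≁v (inj₂ (⇝-respʳ-≈ (sym (inverseʳ-unique x v w≈ε)) (⇝-⁻¹ x)))
      ¬w⇝x : ¬ w ⇝ x
      ¬w⇝x w⇝x =
        x≁v (comparable-through w≉ε (inj₂ w⇝x) (inj₂ (⇝-respʳ-≈ x⁻¹w≈v (⇝-∙ (⇝-⁻¹ʳ w⇝x) ⇝-refl))))
      x≁w : ¬ Comparable x w
      x≁w (inj₁ w⇝x) = ¬w⇝x w⇝x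
      x≁w (inj₂ x⇝w) = x≁v (inj₂ (⇝-respʳ-≈ x⁻¹w≈v (⇝-∙ (⇝-⁻¹ x) x⇝w)))
      v≁w : ¬ Comparable v w
      v≁w (inj₁ w⇝v) = ¬w⇝x (⇝-respʳ-≈ wv⁻¹≈x (⇝-∙ ⇝-refl (⇝-⁻¹ʳ w⇝v)))
      v≁w (inj₂ v⇝w) = x≁v (inj₁ (⇝-respʳ-≈ wv⁻¹≈x (⇝-∙ v⇝w (⇝-⁻¹ v))))

    nonInvolution⇒total : ∀ {x} → ¬ x ∙ x ≈ ε → ∀ u v → Comparable u v
    nonInvolution⇒total x∙x≉ε u v =
      comparable-through (λ x≈ε → x∙x≉ε (trans (∙-cong x≈ε x≈ε) (identityˡ ε)))
        (comparable-nonInvolution x∙x≉ε u) (comparable-nonInvolution x∙x≉ε v)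

  closedSubset-size≤n : ∀ {s} → ClosedSubset s → s ≤ n
  closedSubset-size≤n S = FinP.injective⇒≤ (element-injective ∘ from-injective)
    where open ClosedSubset S

  covering⇒n≤size : ∀ {s} (S : ClosedSubset s) → (∀ y → ∃[ i ] ClosedSubset.element S i ≈ y) → n ≤ s
  covering⇒n≤size S covers = FinP.injective⇒≤ {f = index ∘ to} λ {j} {j′} same → to-injective (begin
    to j                     ≈⟨ proj₂ (covers (to j)) ⟨
    element (index (to j))   ≡⟨ ≡.cong element same ⟩
    element (index (to j′))  ≈⟨ proj₂ (covers (to j′)) ⟩
    to j′                    ∎)
    where
    open ClosedSubset S
    index : Carrier → Fin _
    index y = proj₁ (covers y)

  exponent2⇒powerOf2 : (∀ x → x ∙ x ≈ ε) → IsPowerOf2 n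
  exponent2⇒powerOf2 x∙x≈ε = grow n trivialSubset (0 , ≡.refl) (ℕP.n≤1+n n)
    where
    open Exponent2 x∙x≈ε
    grow : ∀ {s} fuel → ClosedSubset s → IsPowerOf2 s → n ≤ s + fuel → IsPowerOf2 n
    grow {s} zero S s-pow n≤s+0 =
      ≡.subst IsPowerOf2 (ℕP.≤-antisym (closedSubset-size≤n S) (≡.subst (n ≤_) (ℕP.+-identityʳ s) n≤s+0)) s-pow
    grow {s} (suc fuel) S s-pow n≤s+1+fuel
      with ∀⊎∃¬ (λ y≈z (i , eᵢ≈y) → i , trans eᵢ≈y y≈z)
                (λ y → FinP.any? (λ i → ClosedSubset.element S i ≈? y))
    ... | inj₁ covers =
      ≡.subst IsPowerOf2 (ℕP.≤-antisym (closedSubset-size≤n S) (covering⇒n≤size S covers)) s-pow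
    ... | inj₂ (y , y∉S) = grow fuel (double S y∉S) (isPowerOf2-double s-pow) n≤s+s+fuel
      where
      1≤s : 1 ≤ s
      1≤s = ≡.subst (1 ≤_) (≡.sym (proj₂ s-pow)) (ℕP.m^n>0 2 (proj₁ s-pow))
      n≤s+s+fuel : n ≤ s + s + fuel
      n≤s+s+fuel = ℕP.≤-trans (≡.subst (n ≤_) (ℕP.+-suc s fuel) n≤s+1+fuel)
                              (ℕP.+-monoˡ-≤ fuel (ℕP.+-monoˡ-≤ s 1≤s))

  diamondCoDiamondFree⇒classified : DiamondCoDiamondFree G →
    (IsCyclic G × IsPrimePower n) ⊎ (IsPowerOf2 n × HasExponent G 2)
  diamondCoDiamondFree⇒classified free
    with ∀⊎∃¬ (λ x≈y x∙x≈ε → trans (∙-cong (sym x≈y) (sym x≈y)) x∙x≈ε) (λ x → x ∙ x ≈? ε)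
  ... | inj₂ (x , x∙x≉ε) = inj₁ (cyclic , Generator.total⇒primePower (proj₂ cyclic) total)
    where
    total = nonInvolution⇒total free x∙x≉ε
    cyclic = total⇒cyclic total
  ... | inj₁ x∙x≈ε with ∀⊎∃¬ (λ x≈y x≈ε → trans (sym x≈y) x≈ε) (_≈? ε)
  ...   | inj₂ (x , x≉ε) = inj₂ (exponent2⇒powerOf2 x∙x≈ε , Exponent2.hasExponent2 x∙x≈ε x≉ε)
  ...   | inj₁ trivial with exponent2⇒powerOf2 x∙x≈ε
  ...     | k , n≡2ᵏ = inj₁ ((ε , λ x → 0 , trivial x) , 2 , k , prime[2] , n≡2ᵏ)

  classified⇒diamondCoDiamondFree : (IsCyclic G × IsPrimePower n) ⊎ (IsPowerOf2 n × HasExponent G 2) →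
    DiamondCoDiamondFree G
  classified⇒diamondCoDiamondFree (inj₁ ((_ , generates) , _ , k , p-prime , n≡pᵏ)) =
    total⇒diamondCoDiamondFree (Generator.primePower⇒total generates {k = k} p-prime n≡pᵏ)
  classified⇒diamondCoDiamondFree (inj₂ (_ , exponent2)) =
    Exponent2.diamondCoDiamondFree (hasExponent2⇒∙≈ε exponent2)

mainTheorem4 : ∀ {c ℓ} (G : Group c ℓ) (n : ℕ) → HasOrder G n →
    DiamondCoDiamondFree G ⇔
      ((IsCyclic G × IsPrimePower n) ⊎ (IsPowerOf2 n × HasExponent G 2))
mainTheorem4 G n G-order =
  mk⇔ (diamondCoDiamondFree⇒classified G-order) (classified⇒diamondCoDiamondFree G-order)
  where open FiniteGroup G
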